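{- Let $G'=(P\sqcup Q,E')$ be a connected bipartite graph with parts $P$ and $Q$. If $G'$ has no saturated vertex, then the partition completion $C(G')$ has no simplicial vertex.
   Context: A vertex of a bipartite graph $(P\sqcup Q,E')$ is saturated if it is adjacent to every vertex of the other part. The partition completion $C(G')$ is the graph obtained from $G'$ by adding all edges between distinct vertices of $P$ and all edges between distinct vertices of $Q$ (so $P$ and $Q$ become cliques). A vertex $x$ of a graph is simplicial if its neighbourhood $N(x)$ is a clique. -}

module Defs where

open import Data.Nat using (ℕ)
open import Data.Fin using (Fin)
open import Data.Sum using (_⊎_; inj₁; inj₂)
open import Data.Product using (_×_)
open import Data.Empty using (⊥)
open import Relation.Nullary using (¬_)
open import Relation.Binary.PropositionalEquality using (_≡_)
open import Level using (Level; _⊔_) renaming (zero to lzero)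

record BipGraph : Set₁ where
  field
    p q : ℕ
    E   : Fin p → Fin q → Set

module _ (G : BipGraph) where
  open BipGraph G

  V : Set
  V = Fin p ⊎ Fin q

  Adj : V → V → Set
  Adj (inj₁ x) (inj₁ y) = ⊥
  Adj (inj₁ x) (inj₂ y) = E x y
  Adj (inj₂ x) (inj₁ y) = E y x
  Adj (inj₂ x) (inj₂ y) = ⊥

  data Walk : V → V → Set where
    nil  : ∀ {u} → Walk u u
    cons : ∀ {u v w} → Adj u v → Walk v w → Walk u w

  record Connected : Set where
    field
      nonempty : V
      walk     : ∀ u v → Walk u v

  Saturated : V → Set
  Saturated (inj₁ x) = ∀ (y : Fin q) → E x y
  Saturated (inj₂ y) = ∀ (x : Fin p) → E x y

  AdjC : V → V → Set
  AdjC (inj₁ x) (inj₁ y) = ¬ (x ≡ y)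
  AdjC (inj₁ x) (inj₂ y) = E x y
  AdjC (inj₂ x) (inj₁ y) = E y x
  AdjC (inj₂ x) (inj₂ y) = ¬ (x ≡ y)

  SimplicialC : V → Set
  SimplicialC x = ∀ u w → AdjC x u → AdjC x w → ¬ (u ≡ w) → AdjC u w

-- If x is simplicial in C(G') and y is a G'-neighbour of x, then every other vertex x'
-- of x's part is a C(G')-neighbour of x distinct from y, so x' is adjacent to y: y is
-- saturated. A neighbour y of x exists by connectivity, since the other part is
-- nonempty (otherwise x would be vacuously saturated).
module Submission where

open import Data.Fin using (Fin; zero; _≟_)
open import Data.Fin.Properties using (¬Fin0)
open import Data.Nat using (ℕ; zero; suc)
open import Data.Product using (∃; _,_)
open import Data.Sum using (_⊎_; inj₁; inj₂)
open import Relation.Nullary using (¬_; yes; no; contradiction)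
open import Relation.Binary.PropositionalEquality using (_≢_; refl)

open import Defs

inhabited-or-empty : (n : ℕ) → Fin n ⊎ ¬ Fin n
inhabited-or-empty zero    = inj₂ ¬Fin0
inhabited-or-empty (suc n) = inj₁ zero

module _ (G : BipGraph) where
  open BipGraph G

  walk-first-step : ∀ {u w} → Walk G u w → u ≢ w → ∃ (Adj G u)
  walk-first-step nil                u≢u = contradiction refl u≢u
  walk-first-step (cons {v = v} e _) _   = v , e

  unsaturated⇒other-side : ∀ v → ¬ Saturated G v → ∃ λ w → v ≢ w
  unsaturated⇒other-side (inj₁ x) ¬sat with inhabited-or-empty q
  ... | inj₁ y   = inj₂ y , λ ()
  ... | inj₂ ¬y  = contradiction (λ y → contradiction y ¬y) ¬sat
  unsaturated⇒other-side (inj₂ y) ¬sat with inhabited-or-empty p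
  ... | inj₁ x   = inj₁ x , λ ()
  ... | inj₂ ¬x  = contradiction (λ x → contradiction x ¬x) ¬sat

  simplicial-neighbour-saturated : ∀ v {u} → SimplicialC G v → Adj G v u → Saturated G u
  simplicial-neighbour-saturated (inj₁ x) {inj₂ y} simp e x' with x ≟ x'
  ... | yes refl = e
  ... | no x≢x'  = simp (inj₁ x') (inj₂ y) x≢x' e (λ ())
  simplicial-neighbour-saturated (inj₂ y) {inj₁ x} simp e y' with y ≟ y'
  ... | yes refl = e
  ... | no y≢y'  = simp (inj₁ x) (inj₂ y') e y≢y' (λ ())

lemma2 : (G : BipGraph) → Connected G →
         (∀ v → ¬ Saturated G v) →
         ∀ v → ¬ SimplicialC G v
lemma2 G connected unsaturated v simplicial =
  let w , v≢w = unsaturated⇒other-side G v (unsaturated v)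
      u , e   = walk-first-step G (Connected.walk connected v w) v≢w
  in  unsaturated u (simplicial-neighbour-saturated G v simplicial e)
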